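{- Let $T$ be an infinitely splitting Suslin tree. Then every finitely splitting subtree of $T$ is countable.
   Context: A tree is a strict partial order $(T,<)$ in which $\{y:y<x\}$ is well-ordered for every $x$. An $\aleph_1$-tree is a tree of height $\omega_1$ with all levels countable. A Suslin tree is an $\aleph_1$-tree with no uncountable chains and no uncountable antichains. $T$ is infinitely splitting if every node of $T$ has infinitely many immediate successors. A subtree of $T$ is a downward closed subset $S\subseteq T$; it is finitely splitting if every $x\in S$ has only finitely many immediate successors in $S$. -}

module Defs where

open import Data.Nat using (ℕ)
open import Data.List using (List)
open import Data.List.Membership.Propositional using (_∈_)
open import Data.Product using (Σ; Σ-syntax; _×_; proj₁)
open import Data.Sum using (_⊎_)
open import Data.Empty using (⊥)
open import Relation.Nullary using (¬_)
open import Relation.Binary.PropositionalEquality using (_≡_)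
open import Induction.WellFounded using (Acc; WellFounded)

record Tree : Set₁ where
  field
    Carrier    : Set
    _<_        : Carrier → Carrier → Set
    irrefl     : ∀ x → ¬ (x < x)
    trans      : ∀ {x y z} → x < y → y < z → x < z
    pred-linear : ∀ x y z → y < x → z < x → (y < z) ⊎ (y ≡ z) ⊎ (z < y)
    pred-wf    : ∀ x y → y < x → Acc _<_ y

module _ (T : Tree) where
  open Tree T

  Countable : (Carrier → Set) → Set
  Countable P = Σ[ f ∈ (Σ Carrier P → ℕ) ]
                  (∀ a b → f a ≡ f b → proj₁ a ≡ proj₁ b)

  Finite : (Carrier → Set) → Set
  Finite P = Σ[ xs ∈ List Carrier ] (∀ y → P y → y ∈ xs)

  -- x and y have the same height: the well-orders {z | z < x} and
  -- {w | w < y} are order-isomorphic (f restricted to {z | z < x}).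
  SameHeight : Carrier → Carrier → Set
  SameHeight x y =
    Σ[ f ∈ (Carrier → Carrier) ]
      ((∀ z → z < x → f z < y)
      × (∀ z z' → z < x → z' < x → (z < z' → f z < f z') × (f z < f z' → z < z'))
      × (∀ w → w < y → Σ[ z ∈ Carrier ] (z < x × f z ≡ w)))

  Level : Carrier → Carrier → Set
  Level x y = SameHeight x y

  -- A countable ordinal, presented as a strict well-order on a countable set.
  record CountableWellOrder : Set₁ where
    field
      W       : Set
      _≺_     : W → W → Set
      w-irrefl : ∀ a → ¬ (a ≺ a)
      w-trans : ∀ {a b c} → a ≺ b → b ≺ c → a ≺ c
      w-linear : ∀ a b → (a ≺ b) ⊎ (a ≡ b) ⊎ (b ≺ a)
      w-wf    : WellFounded _≺_
      enum    : W → ℕ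
      enum-inj : ∀ a b → enum a ≡ enum b → a ≡ b

  HasHeight : CountableWellOrder → Carrier → Set
  HasHeight α x =
    Σ[ f ∈ (W → Carrier) ]
      ((∀ a → f a < x)
      × (∀ a b → (a ≺ b → f a < f b) × (f a < f b → a ≺ b))
      × (∀ z → z < x → Σ[ a ∈ W ] (f a ≡ z)))
    where open CountableWellOrder α

  -- Height of T is ω₁: every node has countable height (its set of
  -- predecessors is countable), and every countable ordinal is the height
  -- of some node.
  HeightOmega1 : Set₁
  HeightOmega1 =
    (∀ x → Countable (λ y → y < x))
    × (∀ (α : CountableWellOrder) → Σ[ x ∈ Carrier ] HasHeight α x)

  Aleph1Tree : Set₁
  Aleph1Tree = HeightOmega1 × (∀ x → Countable (Level x))

  Chain : (Carrier → Set) → Set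
  Chain C = ∀ x y → C x → C y → (x < y) ⊎ (x ≡ y) ⊎ (y < x)

  Antichain : (Carrier → Set) → Set
  Antichain A = ∀ x y → A x → A y → ¬ (x < y)

  SuslinTree : Set₁
  SuslinTree =
    Aleph1Tree
    × (¬ (Σ[ C ∈ (Carrier → Set) ] (Chain C × ¬ Countable C)))
    × (¬ (Σ[ A ∈ (Carrier → Set) ] (Antichain A × ¬ Countable A)))

  ImmSucc : Carrier → Carrier → Set
  ImmSucc x y = (x < y) × ¬ (Σ[ z ∈ Carrier ] (x < z × z < y))

  InfinitelySplitting : Set
  InfinitelySplitting = ∀ x → ¬ Finite (ImmSucc x)

  Subtree : (Carrier → Set) → Set
  Subtree S = ∀ x y → S x → y < x → S y

  FinitelySplitting : (Carrier → Set) → Set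
  FinitelySplitting S = ∀ x → S x → Finite (λ y → ImmSucc x y × S y)

{-# OPTIONS --safe #-}
module Submission where

-- Send each node x of S to a chosen immediate successor of x outside S; such a
-- successor exists because x has infinitely many immediate successors but only
-- finitely many in S. These successors form an antichain (S is downward
-- closed), hence a countable set in a Suslin tree, and the map is injective
-- because a node has at most one immediate predecessor.

open import Defs
open import Level using (0ℓ)
open import Axiom.ExcludedMiddle using (ExcludedMiddle)
open import Data.Product using (Σ; Σ-syntax; _×_; _,_; proj₁)
open import Data.Sum using (inj₁; inj₂)
open import Data.Empty using (⊥-elim)
open import Relation.Nullary using (¬_; yes; no)
open import Relation.Binary.PropositionalEquality using (_≡_; refl)

module _ (T : Tree) where
  open Tree T

  countable-by-injection : {P Q : Carrier → Set} → Countable T Q →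
    (g : Σ Carrier P → Σ Carrier Q) →
    (∀ a b → proj₁ (g a) ≡ proj₁ (g b) → proj₁ a ≡ proj₁ b) → Countable T P
  countable-by-injection (f , f-inj) g g-inj =
    (λ a → f (g a)) , λ a b e → g-inj a b (f-inj (g a) (g b) e)

  immPred-unique : ∀ {x x' y} → ImmSucc T x y → ImmSucc T x' y → x ≡ x'
  immPred-unique {x} {x'} {y} (x<y , x-imm) (x'<y , x'-imm)
    with pred-linear y x x' x<y x'<y
  ... | inj₁ x<x'        = ⊥-elim (x-imm (x' , x<x' , x'<y))
  ... | inj₂ (inj₁ x≡x') = x≡x'
  ... | inj₂ (inj₂ x'<x) = ⊥-elim (x'-imm (x , x'<x , x<y))

  Frontier : (Carrier → Set) → Carrier → Set
  Frontier S y = ¬ S y × Σ[ x ∈ Carrier ] (S x × ImmSucc T x y)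

  frontier-antichain : ∀ {S} → Subtree T S → Antichain T (Frontier S)
  frontier-antichain {S} S-closed y y' (y∉S , _) (_ , x' , x'∈S , x'<y' , x'-imm) y<y'
    with pred-linear y' y x' y<y' x'<y'
  ... | inj₁ y<x'        = y∉S (S-closed x' y x'∈S y<x')
  ... | inj₂ (inj₁ refl) = y∉S x'∈S
  ... | inj₂ (inj₂ x'<y) = x'-imm (y , x'<y , y<y')

  suslin⇒antichain-countable : ExcludedMiddle 0ℓ → SuslinTree T →
    ∀ {A} → Antichain T A → Countable T A
  suslin⇒antichain-countable lem (_ , _ , no-uncountable-antichain) {A} A-anti
    with lem {Countable T A}
  ... | yes A-countable = A-countable
  ... | no A-uncountable = ⊥-elim (no-uncountable-antichain (A , A-anti , A-uncountable))

  immSucc-outside : ExcludedMiddle 0ℓ → InfinitelySplitting T →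
    ∀ {S} → FinitelySplitting T S →
    ∀ x → S x → Σ[ y ∈ Carrier ] (ImmSucc T x y × ¬ S y)
  immSucc-outside lem inf {S} S-fin x x∈S
    with S-fin x x∈S | lem {Σ[ y ∈ Carrier ] (ImmSucc T x y × ¬ S y)}
  ... | _ | yes found = found
  ... | succs-in-S , covers | no none =
    ⊥-elim (inf x (succs-in-S , λ y x⋖y → covers y (x⋖y , inS y x⋖y)))
    where
    inS : ∀ y → ImmSucc T x y → S y
    inS y x⋖y with lem {S y}
    ... | yes y∈S = y∈S
    ... | no y∉S  = ⊥-elim (none (y , x⋖y , y∉S))

theorem4p12 : ExcludedMiddle 0ℓ → (T : Tree) → SuslinTree T → InfinitelySplitting T →
    (S : Tree.Carrier T → Set) → Subtree T S → FinitelySplitting T S → Countable T S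
theorem4p12 lem T suslin inf S S-closed S-fin =
  countable-by-injection T frontier-countable exit exit-injective
  where
  frontier-countable : Countable T (Frontier T S)
  frontier-countable =
    suslin⇒antichain-countable T lem suslin (frontier-antichain T S-closed)

  outside : (p : Σ _ S) → Σ[ y ∈ _ ] (ImmSucc T (proj₁ p) y × ¬ S y)
  outside (x , x∈S) = immSucc-outside T lem inf S-fin x x∈S

  exit : Σ _ S → Σ _ (Frontier T S)
  exit p@(x , x∈S) with outside p
  ... | y , x⋖y , y∉S = y , y∉S , x , x∈S , x⋖y

  exit-injective : ∀ a b → proj₁ (exit a) ≡ proj₁ (exit b) → proj₁ a ≡ proj₁ b
  exit-injective a b e with outside a | outside b
  ... | _ , a⋖y , _ | _ , b⋖y , _ rewrite e = immPred-unique T a⋖y b⋖y
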